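{- Consider the Windows Scheduling Problem with $m$ machines, $n$ unit-size jobs with exact periods $p_1,\ldots,p_n$ and machine migration allowed. A given schedule, specified by integer start times $t_1,\ldots,t_n$, is infeasible if and only if there exists a set $K$ of $m+1$ jobs such that every pair of jobs in $K$ collides in that schedule.
   Context: In the schedule given by start times $t_1,\ldots,t_n$, job $j$ is executed exactly in time slots $t_j+kp_j$ ($k\in\mathbb{Z}$). With migration allowed, a schedule is feasible iff in every time slot at most $m$ jobs are executed. Two jobs collide if there is a time slot in which both are executed. -}

module Defs where

open import Data.Nat using (ℕ; suc; _≤_)
open import Data.Integer using (ℤ; _+_; _*_; +_)
open import Data.Fin using (Fin)
open import Data.Fin.Subset using (Subset; _∈_; ∣_∣)
open import Data.Product using (Σ; ∃; ∃-syntax; _×_)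
open import Relation.Binary.PropositionalEquality using (_≡_; _≢_)
open import Relation.Nullary using (¬_)

Executes : {n : ℕ} (p : Fin n → ℕ) (t : Fin n → ℤ) → Fin n → ℤ → Set
Executes p t j s = ∃[ k ] (s ≡ t j + k * + (p j))

Collide : {n : ℕ} (p : Fin n → ℕ) (t : Fin n → ℤ) → Fin n → Fin n → Set
Collide p t i j = ∃[ s ] (Executes p t i s × Executes p t j s)

-- Feasible (migration allowed, m machines): in every time slot at most m
-- jobs are executed, i.e. every set of jobs all executed in slot s has
-- at most m elements.
Feasible : {n : ℕ} (m : ℕ) (p : Fin n → ℕ) (t : Fin n → ℤ) → Set
Feasible {n} m p t =
  (s : ℤ) (S : Subset n) → (∀ j → j ∈ S → Executes p t j s) → ∣ S ∣ ≤ m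

PairwiseCollidingSet : {n : ℕ} (m : ℕ) (p : Fin n → ℕ) (t : Fin n → ℤ) → Set
PairwiseCollidingSet {n} m p t =
  Σ (Subset n) λ K → (∣ K ∣ ≡ suc m) ×
    (∀ i j → i ∈ K → j ∈ K → i ≢ j → Collide p t i j)

-- Job j runs exactly in the slots s ≡ t j (mod p j), so by Bézout two jobs collide iff
-- t i ≡ t j (mod gcd (p i) (p j)).  By the Chinese remainder theorem for arbitrary
-- moduli, pairwise solvable congruences are simultaneously solvable, so m + 1 pairwise
-- colliding jobs all run in one common slot and the schedule is infeasible.  Conversely
-- an overfull slot contains m + 1 jobs, which pairwise collide in it.  Collision is
-- decidable, hence so is the existence of such a set, which makes the latter direction
-- constructive.
module Submission where

open import Defs
open import Data.Nat as ℕ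
  using (ℕ; zero; suc; NonZero; ≢-nonZero; _≤_; _≤?_; s≤s)
open import Data.Nat.Properties as ℕ using (*-comm; ≰⇒>; <-irrefl)
open import Data.Nat.Divisibility
  using (_∣_; ∣-trans; *-monoˡ-∣; *-pres-∣; *-cancelˡ-∣; module ∣-Reasoning)
open import Data.Nat.GCD
  using (gcd; gcd[m,n]∣m; gcd[m,n]∣n; gcd-greatest; gcd[m,n]≢0;
         c*gcd[m,n]≡gcd[cm,cn]; gcd-GCD; module Bézout)
open import Data.Nat.LCM using (lcm; m∣lcm[m,n]; n∣lcm[m,n]; lcm-least; gcd*lcm)
open import Data.Integer as ℤ using (ℤ; +_; _+_; _*_; _-_; -_)
open import Data.Integer.Properties as ℤ using (pos-+; pos-*; +-minus-telescope)
open import Data.Integer.Divisibility.Signed as ℤ∣ using (divides; ∣ᵤ⇒∣; ∣⇒∣ᵤ)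
open import Data.Integer.Tactic.RingSolver using (solve-∀)
open import Data.Fin using (Fin)
open import Data.Fin.Properties using (all?) renaming (_≟_ to _≟ᶠ_)
open import Data.Fin.Subset using (Subset; inside; outside; _∈_; _⊆_; ∣_∣; ⊥)
open import Data.Fin.Subset.Properties using (_∈?_; anySubset?; out⊆; in⊆in; ⊥⊆; ∣⊥∣≡0)
open import Data.Vec using (_∷_; [])
open import Data.List using (List; []; _∷_; allFin)
open import Data.List.Relation.Unary.All as All using (All; []; _∷_)
open import Data.List.Membership.Propositional.Properties using (∈-allFin)
open import Data.Product using (∃; ∃₂; ∃-syntax; _×_; _,_)
open import Data.Sum using (inj₁; inj₂)
open import Function.Base using (_∘_)
open import Function.Bundles using (_⇔_; mk⇔)
open import Level using (Level)
open import Relation.Binary.PropositionalEquality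
  using (_≡_; _≢_; refl; sym; trans; cong; subst; module ≡-Reasoning)
open import Relation.Nullary using (¬_; Dec; yes; no; ¬?; contradiction)
open import Relation.Nullary.Decidable using (map′; decidable-stable; _×-dec_; _→-dec_)
open import Relation.Unary using (Pred; Decidable)

∣lcm⇒∣lcm[gcd,gcd] : ∀ {g} p q .{{_ : NonZero p}} →
                     g ∣ lcm p q → g ∣ lcm (gcd g p) (gcd g q)
∣lcm⇒∣lcm[gcd,gcd] {g} p q g∣lcm = *-cancelˡ-∣ w wg∣w*lcm[u,v]
  -- w * lcm u v = u * v, and w * g divides both v * g and v * p, hence u * v.
  where
  u = gcd g p
  v = gcd g q
  w = gcd u v
  instance
    w≢0 : NonZero w
    w≢0 = ≢-nonZero (gcd[m,n]≢0 u v (inj₁ (gcd[m,n]≢0 g p (inj₂ (ℕ.≢-nonZero⁻¹ p)))))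
  w∣p : w ∣ p
  w∣p = ∣-trans (gcd[m,n]∣m u v) (gcd[m,n]∣n g p)
  w∣v : w ∣ v
  w∣v = gcd[m,n]∣n u v
  w∣q : w ∣ q
  w∣q = ∣-trans w∣v (gcd[m,n]∣n g q)
  open ∣-Reasoning
  wg∣pq : w ℕ.* g ∣ p ℕ.* q
  wg∣pq = begin
    w ℕ.* g               ∣⟨ *-pres-∣ (gcd-greatest w∣p w∣q) g∣lcm ⟩
    gcd p q ℕ.* lcm p q   ≡⟨ gcd*lcm p q ⟩
    p ℕ.* q               ∎
  wg∣vp : w ℕ.* g ∣ v ℕ.* p
  wg∣vp = begin
    w ℕ.* g                     ∣⟨ gcd-greatest (*-monoˡ-∣ g w∣p) wg∣pq ⟩
    gcd (p ℕ.* g) (p ℕ.* q)     ≡⟨ c*gcd[m,n]≡gcd[cm,cn] p g q ⟨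
    p ℕ.* v                     ≡⟨ *-comm p v ⟩
    v ℕ.* p                     ∎
  wg∣w*lcm[u,v] : w ℕ.* g ∣ w ℕ.* lcm u v
  wg∣w*lcm[u,v] = begin
    w ℕ.* g                     ∣⟨ gcd-greatest (*-monoˡ-∣ g w∣v) wg∣vp ⟩
    gcd (v ℕ.* g) (v ℕ.* p)     ≡⟨ c*gcd[m,n]≡gcd[cm,cn] v g p ⟨
    v ℕ.* u                     ≡⟨ *-comm v u ⟩
    u ℕ.* v                     ≡⟨ gcd*lcm u v ⟨
    w ℕ.* lcm u v               ∎

gcd[lcm[p,q],r]∣lcm[gcd[p,r],gcd[q,r]] : ∀ p q r →
  gcd (lcm p q) r ∣ lcm (gcd p r) (gcd q r)
gcd[lcm[p,q],r]∣lcm[gcd[p,r],gcd[q,r]] zero q r = m∣lcm[m,n] (gcd 0 r) (gcd q r)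
gcd[lcm[p,q],r]∣lcm[gcd[p,r],gcd[q,r]] p@(suc _) q r =
  ∣-trans (∣lcm⇒∣lcm[gcd,gcd] p q (gcd[m,n]∣m (lcm p q) r))
          (lcm-least (∣-trans (gcd[g,x]∣gcd[x,r] p) (m∣lcm[m,n] (gcd p r) (gcd q r)))
                     (∣-trans (gcd[g,x]∣gcd[x,r] q) (n∣lcm[m,n] (gcd p r) (gcd q r))))
  where
  g = gcd (lcm p q) r
  gcd[g,x]∣gcd[x,r] : ∀ x → gcd g x ∣ gcd x r
  gcd[g,x]∣gcd[x,r] x =
    gcd-greatest (gcd[m,n]∣n g x) (∣-trans (gcd[m,n]∣m g x) (gcd[m,n]∣n (lcm p q) r))

d+ab≡ce⇒d≡ce-ab : ∀ {d} a b c e → d ℕ.+ a ℕ.* b ≡ c ℕ.* e → + d ≡ + c * + e - + a * + b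
d+ab≡ce⇒d≡ce-ab {d} a b c e eq = begin
  + d                            ≡⟨ add-sub (+ d) (+ a * + b) ⟩
  (+ d + + a * + b) - + a * + b  ≡⟨ cong (_- + a * + b) lifted ⟩
  + c * + e - + a * + b          ∎
  where
  open ≡-Reasoning
  add-sub : ∀ x y → x ≡ (x + y) - y
  add-sub = solve-∀
  lifted : + d + + a * + b ≡ + c * + e
  lifted = begin
    + d + + a * + b       ≡⟨ cong (λ z → + d + z) (pos-* a b) ⟨
    + d + + (a ℕ.* b)     ≡⟨ pos-+ d (a ℕ.* b) ⟨
    + (d ℕ.+ a ℕ.* b)     ≡⟨ cong +_ eq ⟩
    + (c ℕ.* e)           ≡⟨ pos-* c e ⟩
    + c * + e             ∎

bezout : ∀ p q → ∃₂ λ x y → + gcd p q ≡ x * + p - y * + q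
bezout p q with Bézout.identity (gcd-GCD p q)
... | Bézout.+- x y eq = + x , + y , d+ab≡ce⇒d≡ce-ab y q x p eq
... | Bézout.-+ x y eq = - + x , - + y , (begin
  + gcd p q                 ≡⟨ d+ab≡ce⇒d≡ce-ab x p y q eq ⟩
  + y * + q - + x * + p     ≡⟨ negate-both (+ x) (+ p) (+ y) (+ q) ⟩
  - + x * + p - - + y * + q ∎)
  where
  open ≡-Reasoning
  negate-both : ∀ a b c d → c * d - a * b ≡ - a * b - - c * d
  negate-both = solve-∀

-- A record rather than a synonym for + d ∣ a - b, so that a and b can be inferred.
infix 4 _≡_mod_
record _≡_mod_ (a b : ℤ) (d : ℕ) : Set where
  constructor congruent
  field divides-difference : + d ℤ∣.∣ a - b
open _≡_mod_

module _ {d : ℕ} where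

  ≡-mod-refl : ∀ a → a ≡ a mod d
  ≡-mod-refl a = congruent (divides (+ 0) (trans (ℤ.+-inverseʳ a) (sym (ℤ.*-zeroˡ (+ d)))))

  ≡-mod-sym : ∀ {a b} → a ≡ b mod d → b ≡ a mod d
  ≡-mod-sym {a} {b} (congruent d∣a-b) =
    congruent (subst (+ d ℤ∣.∣_) (negate-difference a b) (ℤ∣.∣m⇒∣-m d∣a-b))
    where
    negate-difference : ∀ x y → - (x - y) ≡ y - x
    negate-difference = solve-∀

  ≡-mod-trans : ∀ {a b c} → a ≡ b mod d → b ≡ c mod d → a ≡ c mod d
  ≡-mod-trans {a} {b} {c} (congruent d∣a-b) (congruent d∣b-c) =
    congruent (subst (+ d ℤ∣.∣_) (+-minus-telescope a b c) (ℤ∣.∣m∣n⇒∣m+n d∣a-b d∣b-c))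

≡-mod-1 : ∀ a b → a ≡ b mod 1
≡-mod-1 a b = congruent (divides (a - b) (sym (ℤ.*-identityʳ (a - b))))

≡-mod-∣ : ∀ {d e a b} → d ∣ e → a ≡ b mod e → a ≡ b mod d
≡-mod-∣ d∣e (congruent e∣a-b) = congruent (ℤ∣.∣-trans (∣ᵤ⇒∣ d∣e) e∣a-b)

≡-mod-lcm : ∀ {d e a b} → a ≡ b mod d → a ≡ b mod e → a ≡ b mod lcm d e
≡-mod-lcm (congruent d∣a-b) (congruent e∣a-b) =
  congruent (∣ᵤ⇒∣ (lcm-least (∣⇒∣ᵤ d∣a-b) (∣⇒∣ᵤ e∣a-b)))

chinese-remainder₂ : ∀ {p q a b} → a ≡ b mod gcd p q →
                     ∃[ x ] (x ≡ a mod p × x ≡ b mod q)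
chinese-remainder₂ {p} {q} {a} {b} (congruent (divides k a-b≡kg)) with bezout p q
... | X , Y , g≡Xp-Yq =
  x , congruent (divides (- (k * X)) (shift a k X (+ p)))
    , congruent (divides (- (k * Y)) (begin
        x - b                                 ≡⟨ reorder a b (k * X * + p) ⟩
        (a - b) - k * X * + p                 ≡⟨ cong (_- k * X * + p) (trans a-b≡kg (cong (k *_) g≡Xp-Yq)) ⟩
        k * (X * + p - Y * + q) - k * X * + p ≡⟨ expand k X (+ p) Y (+ q) ⟩
        - (k * Y) * + q                       ∎))
  where
  open ≡-Reasoning
  x = a - k * X * + p
  shift : ∀ a k X p → (a - k * X * p) - a ≡ - (k * X) * p
  shift = solve-∀
  reorder : ∀ a b c → (a - c) - b ≡ (a - b) - c
  reorder = solve-∀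
  expand : ∀ k X p Y q → k * (X * p - Y * q) - k * X * p ≡ - (k * Y) * q
  expand = solve-∀

≡-mod-gcd-lcm : ∀ {x c a b L q r} → x ≡ c mod L → x ≡ a mod q →
                c ≡ b mod gcd L r → a ≡ b mod gcd q r → x ≡ b mod gcd (lcm L q) r
≡-mod-gcd-lcm {L = L} {q} {r} x≡c x≡a c≡b a≡b =
  ≡-mod-∣ (gcd[lcm[p,q],r]∣lcm[gcd[p,r],gcd[q,r]] L q r)
    (≡-mod-lcm (≡-mod-trans (≡-mod-∣ (gcd[m,n]∣m L r) x≡c) c≡b)
               (≡-mod-trans (≡-mod-∣ (gcd[m,n]∣m q r) x≡a) a≡b))

module _ {ℓ : Level} {n : ℕ} {P : Pred (Fin n) ℓ} (P? : Decidable P)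
         (a : Fin n → ℤ) (d : Fin n → ℕ)
         (compatible : ∀ {i j} → P i → P j → a i ≡ a j mod gcd (d i) (d j)) where

  -- The candidate c is determined modulo L, the lcm of the moduli already handled;
  -- the invariant c-ok is exactly the solvability condition for merging any further job.
  private
    solve-from : (js : List (Fin n)) (c : ℤ) (L : ℕ) →
                 (∀ {j} → P j → c ≡ a j mod gcd L (d j)) →
                 ∃[ x ] (x ≡ c mod L × All (λ j → P j → x ≡ a j mod d j) js)
    solve-from [] c L _ = c , ≡-mod-refl c , []
    solve-from (j ∷ js) c L c-ok with P? j
    ... | no ¬Pj =
      let (x , x≡c , rest) = solve-from js c L c-ok
      in x , x≡c , (λ Pj → contradiction Pj ¬Pj) ∷ rest
    ... | yes Pj =
      let (y , y≡c , y≡aj) = chinese-remainder₂ (c-ok Pj)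
          (x , x≡y , rest) = solve-from js y (lcm L (d j))
                               (λ Pi → ≡-mod-gcd-lcm y≡c y≡aj (c-ok Pi) (compatible Pj Pi))
      in x , ≡-mod-trans (≡-mod-∣ (m∣lcm[m,n] L (d j)) x≡y) y≡c
           , (λ _ → ≡-mod-trans (≡-mod-∣ (n∣lcm[m,n] L (d j)) x≡y) y≡aj) ∷ rest

  chinese-remainder : ∃[ x ] (∀ {j} → P j → x ≡ a j mod d j)
  chinese-remainder =
    let (x , _ , solves) = solve-from (allFin n) (+ 0) 1
                             (λ {j} _ → ≡-mod-∣ (gcd[m,n]∣m 1 (d j)) (≡-mod-1 (+ 0) (a j)))
    in x , λ {j} → All.lookup solves (∈-allFin j)

⊆-of-size : ∀ {k} (S : Subset k) c → c ≤ ∣ S ∣ → ∃[ K ] (K ⊆ S × ∣ K ∣ ≡ c)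
⊆-of-size [] zero _ = [] , (λ ()) , refl
⊆-of-size (outside ∷ S) c c≤∣S∣ with ⊆-of-size S c c≤∣S∣
... | K , K⊆S , ∣K∣≡c = outside ∷ K , out⊆ K⊆S , ∣K∣≡c
⊆-of-size {suc k} (inside ∷ S) zero _ = ⊥ , ⊥⊆ , ∣⊥∣≡0 (suc k)
⊆-of-size (inside ∷ S) (suc c) (s≤s c≤∣S∣) with ⊆-of-size S c c≤∣S∣
... | K , K⊆S , ∣K∣≡c = inside ∷ K , in⊆in K⊆S , cong suc ∣K∣≡c

module _ {n : ℕ} (p : Fin n → ℕ) (t : Fin n → ℤ) where

  executes⇒≡-mod : ∀ {j s} → Executes p t j s → s ≡ t j mod p j
  executes⇒≡-mod {j} (k , s≡tj+kp) =
    congruent (divides k (trans (cong (_- t j) s≡tj+kp) (add-sub (t j) (k * + p j))))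
    where
    add-sub : ∀ a b → (a + b) - a ≡ b
    add-sub = solve-∀

  ≡-mod⇒executes : ∀ {j s} → s ≡ t j mod p j → Executes p t j s
  ≡-mod⇒executes {j} {s} (congruent (divides k s-tj≡kp)) =
    k , trans (sub-add s (t j)) (cong (_+_ (t j)) s-tj≡kp)
    where
    sub-add : ∀ a b → a ≡ b + (a - b)
    sub-add = solve-∀

  collide⇒≡-mod-gcd : ∀ {i j} → Collide p t i j → t i ≡ t j mod gcd (p i) (p j)
  collide⇒≡-mod-gcd {i} {j} (s , i-at-s , j-at-s) =
    ≡-mod-trans (≡-mod-∣ (gcd[m,n]∣m (p i) (p j)) (≡-mod-sym (executes⇒≡-mod i-at-s)))
                (≡-mod-∣ (gcd[m,n]∣n (p i) (p j)) (executes⇒≡-mod j-at-s))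

  ≡-mod-gcd⇒collide : ∀ {i j} → t i ≡ t j mod gcd (p i) (p j) → Collide p t i j
  ≡-mod-gcd⇒collide ti≡tj =
    let (s , s≡ti , s≡tj) = chinese-remainder₂ ti≡tj
    in s , ≡-mod⇒executes s≡ti , ≡-mod⇒executes s≡tj

  collide? : ∀ i j → Dec (Collide p t i j)
  collide? i j = map′ (≡-mod-gcd⇒collide ∘ congruent) (divides-difference ∘ collide⇒≡-mod-gcd)
                      (+ gcd (p i) (p j) ℤ∣.∣? t i - t j)

  pairwise-colliding? : ∀ m → Dec (PairwiseCollidingSet m p t)
  pairwise-colliding? m = anySubset? λ K → (∣ K ∣ ℕ.≟ suc m) ×-dec
    all? λ i → all? λ j → (i ∈? K) →-dec ((j ∈? K) →-dec (¬? (i ≟ᶠ j) →-dec collide? i j))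

  pairwise-colliding⇒common-slot :
    ∀ K → (∀ i j → i ∈ K → j ∈ K → i ≢ j → Collide p t i j) →
    ∃[ s ] (∀ j → j ∈ K → Executes p t j s)
  pairwise-colliding⇒common-slot K collide =
    let (s , s≡t) = chinese-remainder (_∈? K) t p compatible
    in s , λ j j∈K → ≡-mod⇒executes (s≡t j∈K)
    where
    compatible : ∀ {i j} → i ∈ K → j ∈ K → t i ≡ t j mod gcd (p i) (p j)
    compatible {i} {j} i∈K j∈K with i ≟ᶠ j
    ... | yes refl = ≡-mod-refl (t i)
    ... | no i≢j = collide⇒≡-mod-gcd (collide i j i∈K j∈K i≢j)

  pairwise-colliding⇒infeasible : ∀ {m} → PairwiseCollidingSet m p t → ¬ Feasible m p t
  pairwise-colliding⇒infeasible {m} (K , ∣K∣≡1+m , collide) feasible =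
    let (s , K-at-s) = pairwise-colliding⇒common-slot K collide
    in <-irrefl refl (subst (_≤ m) ∣K∣≡1+m (feasible s K K-at-s))

  no-pairwise-colliding⇒feasible : ∀ {m} → ¬ PairwiseCollidingSet m p t → Feasible m p t
  no-pairwise-colliding⇒feasible {m} ¬colliding s S S-at-s with ∣ S ∣ ≤? m
  ... | yes ∣S∣≤m = ∣S∣≤m
  ... | no ∣S∣≰m =
    let (K , K⊆S , ∣K∣≡1+m) = ⊆-of-size S (suc m) (≰⇒> ∣S∣≰m)
    in contradiction (K , ∣K∣≡1+m , λ i j i∈K j∈K _ → s , S-at-s i (K⊆S i∈K) , S-at-s j (K⊆S j∈K))
                     ¬colliding

lemma7 : (m n : ℕ) (p : Fin n → ℕ) (t : Fin n → ℤ) →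
         (∀ j → 1 ≤ p j) →
         (¬ Feasible m p t) ⇔ PairwiseCollidingSet m p t
lemma7 m n p t _ = mk⇔
  (λ infeasible → decidable-stable (pairwise-colliding? p t m)
                    (λ ¬colliding → infeasible (no-pairwise-colliding⇒feasible p t ¬colliding)))
  (pairwise-colliding⇒infeasible p t)
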